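{- Let $q$ be a prime and let $\{V_{q-1}+l : l\in\mathcal{L}\}$ be a tiling of $\mathbb{Z}^{q-1}$ by translates of the semi-cross $V_{q-1}=\{\mathbf{0},\mathbf{e}_1,\dots,\mathbf{e}_{q-1}\}$. Let $W\in\mathbb{Z}^{q-1}$ and let $m,k$ be integers with $1\le m\le q-1$ and $1\le k\le q-1$. Then the number of $Z\in\mathcal{L}$ such that $Z-W$ has exactly $k$ coordinates equal to $m$ and all other coordinates equal to $0$ equals the number of $Z\in\mathcal{L}$ such that $Z-W$ has exactly $k$ coordinates equal to $1$ and all other coordinates equal to $0$.
   Context: A tiling of $\mathbb{Z}^{m}$ by translates of $V$ is a family $\{V+l: l\in\mathcal{L}\}$ such that every $x\in\mathbb{Z}^m$ can be written uniquely as $x=v+l$ with $v\in V$, $l\in\mathcal{L}$. $\mathbf{e}_i$ is the $i$-th standard basis vector. -}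

module Defs where

open import Data.Nat as ℕ using (ℕ; zero; suc)
open import Data.Integer as ℤ using (ℤ; +_; 0ℤ; 1ℤ)
open import Data.Integer.Properties using () renaming (_≟_ to _≟ℤ_)
open import Data.Fin using (Fin)
open import Data.Vec as Vec using (Vec; []; _∷_; zipWith; replicate; count; updateAt)
open import Data.List as List using (List; []; _∷_; filter; length)
open import Data.Vec.Relation.Unary.All using (All; all?)
open import Data.Product using (Σ; _×_; _,_; ∃; ∃₂)
open import Data.Sum using (_⊎_)
open import Relation.Binary.PropositionalEquality using (_≡_)
open import Relation.Nullary using (Dec; yes; no)
open import Relation.Nullary.Decidable using (_×-dec_; _⊎-dec_)
open import Relation.Unary using (Pred; Decidable)
open import Level using (0ℓ)

Point : ℕ → Set
Point n = Vec ℤ n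

_⊕_ : ∀ {n} → Point n → Point n → Point n
_⊕_ = zipWith ℤ._+_

_⊖_ : ∀ {n} → Point n → Point n → Point n
_⊖_ = zipWith ℤ._-_

𝟎 : ∀ {n} → Point n
𝟎 {n} = replicate n 0ℤ

𝐞 : ∀ {n} → Fin n → Point n
𝐞 i = updateAt 𝟎 i (λ _ → 1ℤ)

InSemiCross : ∀ {n} → Point n → Set
InSemiCross v = v ≡ 𝟎 ⊎ ∃ λ i → v ≡ 𝐞 i

IsSemiCrossTiling : ∀ n → Pred (Point n) 0ℓ → Set
IsSemiCrossTiling n L =
  (x : Point n) →
    (∃₂ λ v l → InSemiCross v × L l × x ≡ v ⊕ l)
    × (∀ v l v′ l′ → InSemiCross v → L l → x ≡ v ⊕ l →
                      InSemiCross v′ → L l′ → x ≡ v′ ⊕ l′ →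
                      v ≡ v′ × l ≡ l′)

HasShape : ∀ {n} → ℤ → ℕ → Point n → Set
HasShape m k d = All (λ x → x ≡ m ⊎ x ≡ 0ℤ) d × count (_≟ℤ m) d ≡ k

hasShape? : ∀ {n} (m : ℤ) (k : ℕ) → Decidable (HasShape {n} m k)
hasShape? m k d = all? (λ x → (x ≟ℤ m) ⊎-dec (x ≟ℤ 0ℤ)) d ×-dec (count (_≟ℤ m) d ℕ.≟ k)

vecsOver : (m : ℤ) → (n : ℕ) → List (Point n)
vecsOver m zero = [] ∷ []
vecsOver m (suc n) =
  List.concatMap (λ d → (0ℤ ∷ d) ∷ (m ∷ d) ∷ []) (vecsOver m n)

-- number of Z ∈ L such that Z − W has exactly k coordinates equal to m and others 0.
-- Any such Z is of the form W + d with d ∈ {0,m}^n, so the candidates W + d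
-- (d ∈ vecsOver m n, pairwise distinct when m ≠ 0) contain all of them.
countShape : ∀ {n} (L : Pred (Point n) 0ℓ) → Decidable L →
             (W : Point n) (m : ℤ) (k : ℕ) → ℕ
countShape {n} L L? W m k =
  length (filter (λ Z → L? Z ×-dec hasShape? m k (Z ⊖ W))
                 (List.map (W ⊕_) (vecsOver m n)))

-- Let f be the indicator function of L and, for c ∈ ℤ, let cover c x be the number of points
-- of x + c·V in L; the tiling hypothesis says cover (-1) ≡ 1. Lists of points act on functions
-- ℤⁿ → ℤ by translation and form a commutative semiring, in which the freshman's dream gives
-- (c·V)^p ≡ (pc)·V modulo p. If cover c ≡ 1 then (c·V)^p turns f into the constant q^(p-1),
-- so cover (pc) ≡ q^(p-1) (mod p). For primes p ≠ q this makes every cover (pc) positive, and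
-- since they sum to q over each translate of -V, all of them equal 1: hence cover (-d) ≡ 1 for
-- 0 < d < q. For p = q it makes cover (-q) equal to 0 or q, so f is q-periodic along every
-- axis. Consequently the axial sum Σₜ f(x + c eₜ) is (q-1)·f(x) when q ∣ c and 1 - f(x) otherwise.
-- As q is prime, for 0 < m < q the function y ↦ f(W + m y) satisfies the same axial identities
-- for every m, and these identities together with the value at 0 determine, by induction on k,
-- the sum of such a function over the 0/1-vectors with k ones, which is the count in question.

module Submission where

open import Defs
open import Data.Nat using (ℕ; _≤_; _∸_)
open import Data.Nat.Primality using (Prime)
open import Data.Integer using (+_)
open import Relation.Binary.PropositionalEquality using (_≡_)
open import Relation.Unary using (Pred; Decidable)
open import Level using (0ℓ)

open import Data.Nat as ℕ using (zero; suc; _<_; _!; s≤s; z≤n)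
import Data.Nat.Properties as ℕ
open import Data.Nat.Combinatorics using (_C_; nCn≡1; nCk≡n!/k![n-k]!; k![n∸k]!∣n!)
open import Data.Nat.Divisibility
  using (_∣_; _∤_; _∣?_; divides; ∣1⇒≡1; ∣⇒≤; ∣-trans; m∣m*n; n∣m*n; m%n≡0⇒n∣m)
open import Data.Nat.DivMod using (_/_; _%_; m/n*n≡m; m≡m%n+[m/n]*n; m%n<n)
open import Data.Nat.ListAction using (product)
open import Data.Nat.Primality
  using (euclidsLemma; prime⇒irreducible; prime⇒nonZero; prime⇒nonTrivial; ¬prime[0]; ¬prime[1])
open import Data.Nat.Primality.Factorisation using (PrimeFactorisation; factorise)
open import Data.Fin using (Fin; zero; suc; toℕ; inject₁; fromℕ)
import Data.Fin.Properties as Fin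
open import Data.Product using (∃; _×_; _,_; proj₁; proj₂)
open import Data.Sum as Sum using (_⊎_; inj₁; inj₂)
open import Relation.Nullary using (Dec; yes; no; ¬_; contradiction)
import Relation.Nullary.Decidable as Dec
open import Relation.Binary.PropositionalEquality
  using (_≢_; refl; sym; trans; cong; cong₂; subst; subst₂; module ≡-Reasoning)
open import Algebra.Bundles using (CommutativeSemiring)

private
  variable
    n : ℕ

prime∤1 : ∀ {p} → Prime p → p ∤ 1
prime∤1 pp p∣1 = ¬prime[1] (subst Prime (∣1⇒≡1 p∣1) pp)

prime∤! : ∀ {p j} → Prime p → j < p → p ∤ j !
prime∤! {j = zero} pp _ = prime∤1 pp
prime∤! {j = suc j} pp j<p p∣j! with euclidsLemma (suc j) (j !) pp p∣j!
... | inj₁ p∣1+j = ℕ.<⇒≱ j<p (∣⇒≤ p∣1+j)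
... | inj₂ p∣j!′ = prime∤! pp (ℕ.<-trans (ℕ.n<1+n j) j<p) p∣j!′

prime∣binomial : ∀ {p k} → Prime p → 0 < k → k < p → p ∣ p C k
prime∣binomial {p@(suc r)} {k} pp 0<k k<p
  with euclidsLemma (p C k) (k ! ℕ.* (p ∸ k) !) pp p∣C*k![p∸k]!
  where
  instance _ = k ℕ.!* (p ∸ k) !≢0
  p∣C*k![p∸k]! : p ∣ (p C k) ℕ.* (k ! ℕ.* (p ∸ k) !)
  p∣C*k![p∸k]! = subst (p ∣_)
    (sym (trans (cong (ℕ._* (k ! ℕ.* (p ∸ k) !)) (nCk≡n!/k![n-k]! (ℕ.<⇒≤ k<p)))
                (m/n*n≡m (k![n∸k]!∣n! (ℕ.<⇒≤ k<p)))))
    (m∣m*n (r !))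
... | inj₁ p∣C = p∣C
... | inj₂ p∣k![p∸k]! with euclidsLemma (k !) ((p ∸ k) !) pp p∣k![p∸k]!
...   | inj₁ p∣k! = contradiction p∣k! (prime∤! pp k<p)
...   | inj₂ p∣[p∸k]! = contradiction p∣[p∸k]! (prime∤! pp (ℕ.∸-monoʳ-< 0<k (ℕ.<⇒≤ k<p)))

m∣m^k : ∀ m {k} → 1 ≤ k → m ∣ m ℕ.^ k
m∣m^k m {suc k} _ = m∣m*n (m ℕ.^ k)

prime∣m^k⇒prime∣m : ∀ {p m} k → Prime p → p ∣ m ℕ.^ k → p ∣ m
prime∣m^k⇒prime∣m zero pp p∣1 = contradiction p∣1 (prime∤1 pp)
prime∣m^k⇒prime∣m {m = m} (suc k) pp p∣m^[1+k] with euclidsLemma m (m ℕ.^ k) pp p∣m^[1+k]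
... | inj₁ p∣m = p∣m
... | inj₂ p∣m^k = prime∣m^k⇒prime∣m k pp p∣m^k

∣∧≤⇒≡0⊎≡ : ∀ {q v} .{{_ : ℕ.NonZero q}} → q ∣ v → v ≤ q → v ≡ 0 ⊎ v ≡ q
∣∧≤⇒≡0⊎≡ (divides zero v≡0) _ = inj₁ v≡0
∣∧≤⇒≡0⊎≡ {q} (divides 1 v≡q+0) _ = inj₂ (trans v≡q+0 (ℕ.+-identityʳ q))
∣∧≤⇒≡0⊎≡ {q} (divides (suc (suc k)) v≡) v≤q =
  contradiction (ℕ.≤-trans (ℕ.≤-reflexive (sym v≡)) v≤q)
                (ℕ.<⇒≱ (ℕ.m<m+n q (ℕ.<-≤-trans (ℕ.>-nonZero⁻¹ q) (ℕ.m≤m+n q (k ℕ.* q)))))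

∤⇒+≡suc* : ∀ {q c} .{{_ : ℕ.NonZero q}} → q ∤ c →
           ∃ λ d → ∃ λ s → 1 ≤ d × d < q × c ℕ.+ d ≡ suc s ℕ.* q
∤⇒+≡suc* {q} {c} q∤c =
  q ∸ r , s , ℕ.m<n⇒0<n∸m r<q , ℕ.∸-monoʳ-< (ℕ.n≢0⇒n>0 r≢0) (ℕ.<⇒≤ r<q) , c+[q∸r]≡[1+s]q
  where
  open ≡-Reasoning
  r = c % q
  s = c / q
  r<q : r < q
  r<q = m%n<n c q
  r≢0 : r ≢ 0
  r≢0 r≡0 = q∤c (m%n≡0⇒n∣m c q r≡0)
  c+[q∸r]≡[1+s]q : c ℕ.+ (q ∸ r) ≡ suc s ℕ.* q
  c+[q∸r]≡[1+s]q = begin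
    c ℕ.+ (q ∸ r)                  ≡⟨ cong (ℕ._+ (q ∸ r)) (m≡m%n+[m/n]*n c q) ⟩
    (r ℕ.+ s ℕ.* q) ℕ.+ (q ∸ r)    ≡⟨ cong (ℕ._+ (q ∸ r)) (ℕ.+-comm r (s ℕ.* q)) ⟩
    (s ℕ.* q ℕ.+ r) ℕ.+ (q ∸ r)    ≡⟨ ℕ.+-assoc (s ℕ.* q) r (q ∸ r) ⟩
    s ℕ.* q ℕ.+ (r ℕ.+ (q ∸ r))    ≡⟨ cong (s ℕ.* q ℕ.+_) (ℕ.m+[n∸m]≡n (ℕ.<⇒≤ r<q)) ⟩
    s ℕ.* q ℕ.+ q                  ≡⟨ ℕ.+-comm (s ℕ.* q) q ⟩
    q ℕ.+ s ℕ.* q                  ∎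

-- The freshman's dream

module FreshmansDream {a ℓ} (S : CommutativeSemiring a ℓ) where

  open CommutativeSemiring S
    using (Carrier; _≈_; _+_; _*_; 0#; 1#; setoid; semiring; +-monoid; +-commutativeMonoid;
           +-identityˡ; +-congˡ; +-congʳ; +-cong; +-assoc; +-comm; *-identityˡ; *-identityʳ; *-congˡ)
    renaming (refl to ≈-refl; sym to ≈-sym; trans to ≈-trans)
  open import Algebra.Properties.CommutativeSemiring.Binomial S using (theorem)
  open import Algebra.Properties.Semiring.Binomial semiring using (binomialTerm)
  open import Algebra.Properties.Semiring.Exp semiring using (_^_; ^-congʳ)
  open import Algebra.Properties.Monoid.Sum +-monoid using (sum; sum-init-last; sum-cong-≋)
  open import Algebra.Properties.Monoid.Mult +-monoid
    using (×-homo-1; ×-assocˡ) renaming (_×_ to _×ᵐ_)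
  open import Algebra.Properties.CommutativeMonoid.Mult +-commutativeMonoid using (×-distrib-+)
  open import Relation.Binary.Reasoning.Setoid setoid

  ×ᵐ-zeroʳ : ∀ k → k ×ᵐ 0# ≈ 0#
  ×ᵐ-zeroʳ zero = ≈-refl
  ×ᵐ-zeroʳ (suc k) = ≈-trans (+-identityˡ _) (×ᵐ-zeroʳ k)

  sum-×ᵐ : ∀ k {m} (t : Fin m → Carrier) → sum (λ i → k ×ᵐ t i) ≈ k ×ᵐ sum t
  sum-×ᵐ k {zero} t = ≈-sym (×ᵐ-zeroʳ k)
  sum-×ᵐ k {suc m} t = ≈-trans (+-congˡ (sum-×ᵐ k (λ i → t (suc i)))) (≈-sym (×-distrib-+ _ _ k))

  freshmansDream : ∀ {p} → Prime p → ∀ x y → ∃ λ r → (x + y) ^ p ≈ (x ^ p + y ^ p) + p ×ᵐ r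
  freshmansDream {zero} pp = contradiction pp ¬prime[0]
  freshmansDream {1} pp = contradiction pp ¬prime[1]
  freshmansDream {p@(suc (suc r))} pp x y = sum middle , expansion
    where
    instance _ = prime⇒nonZero pp
    monomial : ℕ → Carrier
    monomial j = x ^ j * y ^ (p ∸ j)
    middle : Fin (suc r) → Carrier
    middle i = ((p C suc (toℕ i)) / p) ×ᵐ monomial (suc (toℕ i))
    first : binomialTerm x y p zero ≈ y ^ p
    first = ≈-trans (×-homo-1 _) (*-identityˡ _)
    interior : ∀ i → binomialTerm x y p (suc (inject₁ i)) ≈ p ×ᵐ middle i
    interior i = begin
      (p C suc (toℕ (inject₁ i))) ×ᵐ monomial (suc (toℕ (inject₁ i)))
        ≡⟨ cong (λ j → (p C suc j) ×ᵐ monomial (suc j)) (Fin.toℕ-inject₁ i) ⟩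
      (p C suc (toℕ i)) ×ᵐ monomial (suc (toℕ i))
        ≡⟨ cong (_×ᵐ monomial (suc (toℕ i))) (sym (trans (ℕ.*-comm p ((p C suc (toℕ i)) / p))
             (m/n*n≡m (prime∣binomial pp (s≤s z≤n) (s≤s (Fin.toℕ<n i)))))) ⟩
      (p ℕ.* ((p C suc (toℕ i)) / p)) ×ᵐ monomial (suc (toℕ i))
        ≈⟨ ×-assocˡ (monomial (suc (toℕ i))) p ((p C suc (toℕ i)) / p) ⟨
      p ×ᵐ middle i ∎
    last : binomialTerm x y p (fromℕ p) ≈ x ^ p
    last = begin
      (p C toℕ (fromℕ p)) ×ᵐ monomial (toℕ (fromℕ p))
        ≡⟨ cong (λ j → (p C j) ×ᵐ monomial j) (Fin.toℕ-fromℕ p) ⟩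
      (p C p) ×ᵐ monomial p
        ≡⟨ cong (_×ᵐ monomial p) (nCn≡1 p) ⟩
      1 ×ᵐ monomial p
        ≈⟨ ×-homo-1 _ ⟩
      x ^ p * y ^ (p ∸ p)
        ≈⟨ *-congˡ (^-congʳ y (ℕ.n∸n≡0 p)) ⟩
      x ^ p * 1#
        ≈⟨ *-identityʳ _ ⟩
      x ^ p ∎
    expansion : (x + y) ^ p ≈ (x ^ p + y ^ p) + p ×ᵐ sum middle
    expansion = begin
      (x + y) ^ p
        ≈⟨ theorem p x y ⟩
      binomialTerm x y p zero + sum (λ i → binomialTerm x y p (suc i))
        ≈⟨ +-congˡ (sum-init-last {suc r} (λ i → binomialTerm x y p (suc i))) ⟩
      binomialTerm x y p zero + (sum (λ i → binomialTerm x y p (suc (inject₁ i))) + binomialTerm x y p (fromℕ p))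
        ≈⟨ +-cong first (+-cong (≈-trans (sum-cong-≋ interior) (sum-×ᵐ p middle)) last) ⟩
      y ^ p + (p ×ᵐ sum middle + x ^ p)
        ≈⟨ +-congˡ (+-comm _ _) ⟩
      y ^ p + (x ^ p + p ×ᵐ sum middle)
        ≈⟨ +-assoc _ _ _ ⟨
      (y ^ p + x ^ p) + p ×ᵐ sum middle
        ≈⟨ +-congʳ (+-comm _ _) ⟩
      (x ^ p + y ^ p) + p ×ᵐ sum middle ∎

open import Data.Integer as ℤ using (ℤ; 0ℤ; 1ℤ; -1ℤ; -_; _+_; _*_) renaming (_≟_ to _≟ℤ_)
import Data.Integer.Properties as ℤ
import Data.Integer.Divisibility.Signed as ℤ
open import Data.Integer.Tactic.RingSolver using (solve-∀)
open import Algebra.Properties.Monoid.Sum ℤ.+-0-monoid using (sum-syntax; sum-cong-≗)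
open import Algebra.Properties.CommutativeSemigroup ℤ.+-commutativeSemigroup
  using () renaming (interchange to +-interchange)
open import Data.List as List using (List; []; _∷_; _++_; [_]; filter; length)
import Data.List.Properties as List
open import Function using (_⇔_; mk⇔; Equivalence)

indicator : ∀ {p} {P : Set p} → Dec P → ℤ
indicator (yes _) = 1ℤ
indicator (no _) = 0ℤ

indicator-yes : ∀ {p} {P : Set p} → P → (P? : Dec P) → indicator P? ≡ 1ℤ
indicator-yes p (yes _) = refl
indicator-yes p (no ¬p) = contradiction p ¬p

indicator-no : ∀ {p} {P : Set p} → ¬ P → (P? : Dec P) → indicator P? ≡ 0ℤ
indicator-no ¬p (yes p) = contradiction p ¬p
indicator-no ¬p (no _) = refl

indicator-nonneg : ∀ {p} {P : Set p} (P? : Dec P) → 0ℤ ℤ.≤ indicator P?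
indicator-nonneg (yes _) = ℤ.+≤+ z≤n
indicator-nonneg (no _) = ℤ.+≤+ z≤n

indicator≤1 : ∀ {p} {P : Set p} (P? : Dec P) → indicator P? ℤ.≤ 1ℤ
indicator≤1 (yes _) = ℤ.+≤+ (s≤s z≤n)
indicator≤1 (no _) = ℤ.+≤+ z≤n

indicator-× : ∀ {p} {P Q : Set p} (P? : Dec P) (Q? : Dec Q) →
              indicator (P? Dec.×-dec Q?) ≡ indicator P? * indicator Q?
indicator-× (yes _) (yes _) = refl
indicator-× (yes _) (no _) = refl
indicator-× (no _) (yes _) = refl
indicator-× (no _) (no _) = refl

indicator-⇔ : ∀ {p} {P Q : Set p} → P ⇔ Q → (P? : Dec P) (Q? : Dec Q) → indicator P? ≡ indicator Q?
indicator-⇔ P⇔Q (yes _) (yes _) = refl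
indicator-⇔ P⇔Q (no _) (no _) = refl
indicator-⇔ P⇔Q (yes p) (no ¬q) = contradiction (Equivalence.to P⇔Q p) ¬q
indicator-⇔ P⇔Q (no ¬p) (yes q) = contradiction (Equivalence.from P⇔Q q) ¬p

0≤∧≢0⇒1≤ : ∀ {i} → 0ℤ ℤ.≤ i → i ≢ 0ℤ → 1ℤ ℤ.≤ i
0≤∧≢0⇒1≤ {+ zero} _ i≢0 = contradiction refl i≢0
0≤∧≢0⇒1≤ {+ suc _} _ _ = ℤ.+≤+ (s≤s z≤n)

∑-const : ∀ m a → ∑[ j < m ] a ≡ + m * a
∑-const zero a = refl
∑-const (suc m) a = trans (cong (_+_ a) (∑-const m a)) (sym (ℤ.suc-* (+ m) a))

∑-0 : ∀ m → ∑[ j < m ] 0ℤ ≡ 0ℤ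
∑-0 m = trans (∑-const m 0ℤ) (ℤ.*-zeroʳ (+ m))

∑-1 : ∀ m → ∑[ j < m ] 1ℤ ≡ + m
∑-1 m = trans (∑-const m 1ℤ) (ℤ.*-identityʳ (+ m))

∑-mono-≤ : ∀ {m} {s t : Fin m → ℤ} → (∀ j → s j ℤ.≤ t j) → ∑[ j < m ] s j ℤ.≤ ∑[ j < m ] t j
∑-mono-≤ {zero} s≤t = ℤ.≤-refl
∑-mono-≤ {suc m} s≤t = ℤ.+-mono-≤ (s≤t zero) (∑-mono-≤ (λ j → s≤t (suc j)))

+-≤-≡⇒≡ˡ : ∀ {a b c d} → a ℤ.≤ b → c ℤ.≤ d → a + c ≡ b + d → a ≡ b
+-≤-≡⇒≡ˡ {a} {b} a≤b c≤d a+c≡b+d with a ℤ.≟ b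
... | yes a≡b = a≡b
... | no a≢b = contradiction a+c≡b+d (ℤ.<⇒≢ (ℤ.+-mono-<-≤ (ℤ.≤∧≢⇒< a≤b a≢b) c≤d))

+-≤-≡⇒≡ : ∀ {a b c d} → a ℤ.≤ b → c ℤ.≤ d → a + c ≡ b + d → a ≡ b × c ≡ d
+-≤-≡⇒≡ {a} {b} {c} {d} a≤b c≤d a+c≡b+d =
  +-≤-≡⇒≡ˡ a≤b c≤d a+c≡b+d ,
  +-≤-≡⇒≡ˡ c≤d a≤b (trans (ℤ.+-comm c a) (trans a+c≡b+d (ℤ.+-comm b d)))

∑-≤-≡⇒≗ : ∀ {m} {s t : Fin m → ℤ} → (∀ j → s j ℤ.≤ t j) →
          ∑[ j < m ] s j ≡ ∑[ j < m ] t j → ∀ j → s j ≡ t j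
∑-≤-≡⇒≗ {suc m} s≤t Σs≡Σt j with +-≤-≡⇒≡ (s≤t zero) (∑-mono-≤ (λ j → s≤t (suc j))) Σs≡Σt
∑-≤-≡⇒≗ {suc m} s≤t Σs≡Σt zero    | s₀≡t₀ , _ = s₀≡t₀
∑-≤-≡⇒≗ {suc m} s≤t Σs≡Σt (suc j) | _ , rest = ∑-≤-≡⇒≗ (λ j → s≤t (suc j)) rest j

∑-indicator-unique : ∀ {m p} {P : Fin m → Set p} (P? : ∀ j → Dec (P j)) →
                     ∃ P → (∀ {i j} → P i → P j → i ≡ j) → ∑[ j < m ] indicator (P? j) ≡ 1ℤ
∑-indicator-unique {suc m} P? (j₀ , pj₀) unique with P? zero | j₀
... | yes p₀ | _ = cong (_+_ 1ℤ)
  (trans (sum-cong-≗ (λ j → indicator-no (λ pj → Fin.0≢1+n (unique p₀ pj)) (P? (suc j)))) (∑-0 m))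
... | no ¬p₀ | zero = contradiction pj₀ ¬p₀
... | no _ | suc j = trans (ℤ.+-identityˡ _)
  (∑-indicator-unique (λ j → P? (suc j)) (j , pj₀) (λ pi pj → Fin.suc-injective (unique pi pj)))

listSum : ∀ {a} {A : Set a} → (A → ℤ) → List A → ℤ
listSum g [] = 0ℤ
listSum g (x ∷ xs) = g x + listSum g xs

module _ {a} {A : Set a} where

  listSum-cong : ∀ {g h : A → ℤ} → (∀ x → g x ≡ h x) → ∀ xs → listSum g xs ≡ listSum h xs
  listSum-cong g≗h [] = refl
  listSum-cong g≗h (x ∷ xs) = cong₂ _+_ (g≗h x) (listSum-cong g≗h xs)

  listSum-++ : ∀ (g : A → ℤ) xs ys → listSum g (xs ++ ys) ≡ listSum g xs + listSum g ys
  listSum-++ g [] ys = sym (ℤ.+-identityˡ _)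
  listSum-++ g (x ∷ xs) ys = trans (cong (_+_ (g x)) (listSum-++ g xs ys)) (sym (ℤ.+-assoc (g x) _ _))

  listSum-+ : ∀ (g h : A → ℤ) xs → listSum (λ x → g x + h x) xs ≡ listSum g xs + listSum h xs
  listSum-+ g h [] = refl
  listSum-+ g h (x ∷ xs) =
    trans (cong (_+_ (g x + h x)) (listSum-+ g h xs)) (+-interchange (g x) (h x) _ _)

  listSum-const : ∀ c xs → listSum (λ (_ : A) → c) xs ≡ + length xs * c
  listSum-const c [] = refl
  listSum-const c (x ∷ xs) = trans (cong (_+_ c) (listSum-const c xs)) (sym (ℤ.suc-* (+ length xs) c))

  listSum-map : ∀ {b} {B : Set b} (g : A → ℤ) (h : B → A) xs →
                listSum g (List.map h xs) ≡ listSum (λ x → g (h x)) xs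
  listSum-map g h [] = refl
  listSum-map g h (x ∷ xs) = cong (_+_ (g (h x))) (listSum-map g h xs)

  listSum-concatMap-pair : ∀ {b} {B : Set b} (g : A → ℤ) (l r : B → A) xs →
    listSum g (List.concatMap (λ x → l x ∷ r x ∷ []) xs) ≡ listSum (λ x → g (l x)) xs + listSum (λ x → g (r x)) xs
  listSum-concatMap-pair g l r [] = refl
  listSum-concatMap-pair g l r (x ∷ xs) =
    trans (cong (λ s → g (l x) + (g (r x) + s)) (listSum-concatMap-pair g l r xs)) (regroup (g (l x)) (g (r x)) _ _)
    where
    regroup : ∀ a b c d → a + (b + (c + d)) ≡ (a + c) + (b + d)
    regroup = solve-∀

  length-filter : ∀ {p} {P : Pred A p} (P? : Decidable P) xs →
                  + length (filter P? xs) ≡ listSum (λ x → indicator (P? x)) xs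
  length-filter P? [] = refl
  length-filter P? (x ∷ xs) with P? x
  ... | yes _ = trans (ℤ.pos-+ 1 _) (cong (_+_ 1ℤ) (length-filter P? xs))
  ... | no _ = trans (length-filter P? xs) (sym (ℤ.+-identityˡ _))

open import Data.Vec as Vec using (Vec; []; _∷_; count)
import Data.Vec.Properties as Vec

infixr 25 _·_

_·_ : ℤ → Point n → Point n
k · v = Vec.map (_*_ k) v

⊕-assoc : (x y z : Point n) → (x ⊕ y) ⊕ z ≡ x ⊕ (y ⊕ z)
⊕-assoc = Vec.zipWith-assoc ℤ.+-assoc

⊕-comm : (x y : Point n) → x ⊕ y ≡ y ⊕ x
⊕-comm = Vec.zipWith-comm ℤ.+-comm

⊕-identityʳ : (x : Point n) → x ⊕ 𝟎 ≡ x
⊕-identityʳ = Vec.zipWith-identityʳ ℤ.+-identityʳ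

⊕-inverseʳ : (x : Point n) → x ⊕ -1ℤ · x ≡ 𝟎
⊕-inverseʳ x = trans (cong (x ⊕_) (Vec.map-cong ℤ.-1*i≡-i x)) (Vec.zipWith-inverseʳ ℤ.+-inverseʳ x)

⊕-⊖-cancelˡ : (x y : Point n) → (x ⊕ y) ⊖ x ≡ y
⊕-⊖-cancelˡ [] [] = refl
⊕-⊖-cancelˡ (a ∷ x) (b ∷ y) = cong₂ _∷_ (cancel a b) (⊕-⊖-cancelˡ x y)
  where
  cancel : ∀ a b → (a + b) ℤ.- a ≡ b
  cancel = solve-∀

·-𝟎 : ∀ {n} k → k · 𝟎 {n} ≡ 𝟎
·-𝟎 {n} k = trans (Vec.map-replicate (_*_ k) 0ℤ n) (cong (Vec.replicate n) (ℤ.*-zeroʳ k))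

·-zeroˡ : (v : Point n) → 0ℤ · v ≡ 𝟎
·-zeroˡ [] = refl
·-zeroˡ (a ∷ v) = cong (0ℤ ∷_) (·-zeroˡ v)

·-identityˡ : (v : Point n) → 1ℤ · v ≡ v
·-identityˡ [] = refl
·-identityˡ (a ∷ v) = cong₂ _∷_ (ℤ.*-identityˡ a) (·-identityˡ v)

·-assoc : ∀ a b (v : Point n) → a · b · v ≡ (a * b) · v
·-assoc a b [] = refl
·-assoc a b (c ∷ v) = cong₂ _∷_ (sym (ℤ.*-assoc a b c)) (·-assoc a b v)

·-distribˡ-⊕ : ∀ k (x y : Point n) → k · (x ⊕ y) ≡ k · x ⊕ k · y
·-distribˡ-⊕ k [] [] = refl
·-distribˡ-⊕ k (a ∷ x) (b ∷ y) = cong₂ _∷_ (ℤ.*-distribˡ-+ k a b) (·-distribˡ-⊕ k x y)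

·-distribʳ-+ : ∀ a b (v : Point n) → (a + b) · v ≡ a · v ⊕ b · v
·-distribʳ-+ a b [] = refl
·-distribʳ-+ a b (c ∷ v) = cong₂ _∷_ (ℤ.*-distribʳ-+ c a b) (·-distribʳ-+ a b v)

⊕-·-+ : ∀ (x : Point n) a b v → (x ⊕ a · v) ⊕ b · v ≡ x ⊕ (a + b) · v
⊕-·-+ x a b v = trans (⊕-assoc x (a · v) (b · v)) (cong (x ⊕_) (sym (·-distribʳ-+ a b v)))

⊕-translate : ∀ (x v : Point n) → x ≡ v ⊕ (x ⊕ -1ℤ · v)
⊕-translate x v = sym (begin
  v ⊕ (x ⊕ -1ℤ · v) ≡⟨ ⊕-comm v _ ⟩
  (x ⊕ -1ℤ · v) ⊕ v ≡⟨ ⊕-assoc x _ v ⟩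
  x ⊕ (-1ℤ · v ⊕ v) ≡⟨ cong (x ⊕_) (⊕-comm _ v) ⟩
  x ⊕ (v ⊕ -1ℤ · v) ≡⟨ cong (x ⊕_) (⊕-inverseʳ v) ⟩
  x ⊕ 𝟎             ≡⟨ ⊕-identityʳ x ⟩
  x                 ∎)
  where open ≡-Reasoning

⊕-translate⁻¹ : ∀ {x v l : Point n} → x ≡ v ⊕ l → l ≡ x ⊕ -1ℤ · v
⊕-translate⁻¹ {v = v} {l} refl = sym (begin
  (v ⊕ l) ⊕ -1ℤ · v ≡⟨ cong (_⊕ -1ℤ · v) (⊕-comm v l) ⟩
  (l ⊕ v) ⊕ -1ℤ · v ≡⟨ ⊕-assoc l v _ ⟩
  l ⊕ (v ⊕ -1ℤ · v) ≡⟨ cong (l ⊕_) (⊕-inverseʳ v) ⟩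
  l ⊕ 𝟎             ≡⟨ ⊕-identityʳ l ⟩
  l                 ∎)
  where open ≡-Reasoning

-- The translation semiring

open import Algebra.Structures using (IsCommutativeMonoid)
open import Algebra.Structures.Biased using (isCommutativeSemiringˡ; isCommutativeMonoidˡ)
open import Relation.Binary.Structures using (IsEquivalence)

act : List (Point n) → (Point n → ℤ) → Point n → ℤ
act D g x = listSum (λ v → g (x ⊕ v)) D

sumset : List (Point n) → List (Point n) → List (Point n)
sumset D E = List.concatMap (λ v → List.map (v ⊕_) E) D

act-cong : ∀ (D : List (Point n)) {g h} → (∀ y → g y ≡ h y) → ∀ x → act D g x ≡ act D h x
act-cong D g≗h x = listSum-cong (λ v → g≗h (x ⊕ v)) D

act-++ : ∀ (D E : List (Point n)) g x → act (D ++ E) g x ≡ act D g x + act E g x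
act-++ D E g x = listSum-++ (λ v → g (x ⊕ v)) D E

act-const : ∀ (D : List (Point n)) c x → act D (λ _ → c) x ≡ + length D * c
act-const D c x = listSum-const c D

act-⊕ʳ : ∀ (D : List (Point n)) g x v → act D g (x ⊕ v) ≡ act D (λ y → g (y ⊕ v)) x
act-⊕ʳ D g x v = listSum-cong (λ w → cong g (⊕-swap w)) D
  where
  ⊕-swap : ∀ w → (x ⊕ v) ⊕ w ≡ (x ⊕ w) ⊕ v
  ⊕-swap w = trans (⊕-assoc x v w) (trans (cong (x ⊕_) (⊕-comm v w)) (sym (⊕-assoc x w v)))

act-sumset : ∀ (D E : List (Point n)) g x → act (sumset D E) g x ≡ act D (act E g) x
act-sumset [] E g x = refl
act-sumset (v ∷ D) E g x = begin
  act (List.map (v ⊕_) E ++ sumset D E) g x            ≡⟨ act-++ (List.map (v ⊕_) E) (sumset D E) g x ⟩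
  act (List.map (v ⊕_) E) g x + act (sumset D E) g x   ≡⟨ cong₂ _+_ translate (act-sumset D E g x) ⟩
  act E g (x ⊕ v) + act D (act E g) x                  ∎
  where
  open ≡-Reasoning
  translate : act (List.map (v ⊕_) E) g x ≡ act E g (x ⊕ v)
  translate = trans (listSum-map (λ u → g (x ⊕ u)) (v ⊕_) E) (listSum-cong (λ w → cong g (sym (⊕-assoc x v w))) E)

act-comm : ∀ (D E : List (Point n)) g x → act D (act E g) x ≡ act E (act D g) x
act-comm [] E g x = sym (trans (act-const E 0ℤ x) (ℤ.*-zeroʳ (+ length E)))
act-comm (v ∷ D) E g x = begin
  act E g (x ⊕ v) + act D (act E g) x              ≡⟨ cong₂ _+_ (act-⊕ʳ E g x v) (act-comm D E g x) ⟩
  act E (λ y → g (y ⊕ v)) x + act E (act D g) x   ≡⟨ listSum-+ _ _ E ⟨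
  act E (act (v ∷ D) g) x                          ∎
  where open ≡-Reasoning

act-[𝟎] : ∀ g (x : Point n) → act [ 𝟎 ] g x ≡ g x
act-[𝟎] g x = trans (ℤ.+-identityʳ _) (cong g (⊕-identityʳ x))

act-tabulate : ∀ {m} (h : Fin m → Point n) g x → act (List.tabulate h) g x ≡ ∑[ j < m ] g (x ⊕ h j)
act-tabulate {m = zero} h g x = refl
act-tabulate {m = suc m} h g x = cong (_+_ (g (x ⊕ h zero))) (act-tabulate (λ j → h (suc j)) g x)

dilate : ℤ → List (Point n) → List (Point n)
dilate c = List.map (c ·_)

dilate-dilate : ∀ a b (D : List (Point n)) → dilate a (dilate b D) ≡ dilate (a * b) D
dilate-dilate a b D = trans (sym (List.map-∘ D)) (List.map-cong (·-assoc a b) D)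

_≋_ : List (Point n) → List (Point n) → Set
D ≋ E = ∀ g x → act D g x ≡ act E g x

≋-isEquivalence : IsEquivalence (_≋_ {n})
≋-isEquivalence = record
  { refl = λ g x → refl
  ; sym = λ D≋E g x → sym (D≋E g x)
  ; trans = λ D≋E E≋F g x → trans (D≋E g x) (E≋F g x)
  }

++-isCommutativeMonoid : IsCommutativeMonoid (_≋_ {n}) _++_ []
++-isCommutativeMonoid = isCommutativeMonoidˡ record
  { isSemigroup = record
    { isMagma = record
      { isEquivalence = ≋-isEquivalence
      ; ∙-cong = λ {D} {D′} {E} {E′} D≋D′ E≋E′ g x →
          trans (act-++ D E g x) (trans (cong₂ _+_ (D≋D′ g x) (E≋E′ g x)) (sym (act-++ D′ E′ g x)))
      }
    ; assoc = λ D E F g x → cong (λ G → act G g x) (List.++-assoc D E F)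
    }
  ; identityˡ = λ D g x → refl
  ; comm = λ D E g x → trans (act-++ D E g x) (trans (ℤ.+-comm (act D g x) (act E g x)) (sym (act-++ E D g x)))
  }

sumset-isCommutativeMonoid : IsCommutativeMonoid (_≋_ {n}) sumset [ 𝟎 ]
sumset-isCommutativeMonoid = isCommutativeMonoidˡ record
  { isSemigroup = record
    { isMagma = record
      { isEquivalence = ≋-isEquivalence
      ; ∙-cong = λ {D} {D′} {E} {E′} D≋D′ E≋E′ g x → begin
          act (sumset D E) g x    ≡⟨ act-sumset D E g x ⟩
          act D (act E g) x       ≡⟨ D≋D′ (act E g) x ⟩
          act D′ (act E g) x      ≡⟨ act-cong D′ (E≋E′ g) x ⟩
          act D′ (act E′ g) x     ≡⟨ act-sumset D′ E′ g x ⟨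
          act (sumset D′ E′) g x  ∎
      }
    ; assoc = λ D E F g x → begin
        act (sumset (sumset D E) F) g x  ≡⟨ act-sumset (sumset D E) F g x ⟩
        act (sumset D E) (act F g) x     ≡⟨ act-sumset D E (act F g) x ⟩
        act D (act E (act F g)) x        ≡⟨ act-cong D (act-sumset E F g) x ⟨
        act D (act (sumset E F) g) x     ≡⟨ act-sumset D (sumset E F) g x ⟨
        act (sumset D (sumset E F)) g x  ∎
    }
  ; identityˡ = λ D g x → trans (act-sumset [ 𝟎 ] D g x) (act-[𝟎] (act D g) x)
  ; comm = λ D E g x → begin
      act (sumset D E) g x  ≡⟨ act-sumset D E g x ⟩
      act D (act E g) x     ≡⟨ act-comm D E g x ⟩
      act E (act D g) x     ≡⟨ act-sumset E D g x ⟨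
      act (sumset E D) g x  ∎
  }
  where open ≡-Reasoning

-- Lists of points, identified when they act alike, form the semiring ℕ[ℤⁿ] with sumset as product.
translationSemiring : ℕ → CommutativeSemiring 0ℓ 0ℓ
translationSemiring n = record
  { isCommutativeSemiring = isCommutativeSemiringˡ {_≈_ = _≋_ {n}} record
    { +-isCommutativeMonoid = ++-isCommutativeMonoid
    ; *-isCommutativeMonoid = sumset-isCommutativeMonoid
    ; distribʳ = λ D E F g x → begin
        act (sumset (E ++ F) D) g x                   ≡⟨ act-sumset (E ++ F) D g x ⟩
        act (E ++ F) (act D g) x                      ≡⟨ act-++ E F (act D g) x ⟩
        act E (act D g) x + act F (act D g) x         ≡⟨ cong₂ _+_ (act-sumset E D g x) (act-sumset F D g x) ⟨
        act (sumset E D) g x + act (sumset F D) g x   ≡⟨ act-++ (sumset E D) (sumset F D) g x ⟨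
        act (sumset E D ++ sumset F D) g x            ∎
    ; zeroˡ = λ D g x → refl
    }
  }
  where open ≡-Reasoning

module Frobenius (n : ℕ) where

  open CommutativeSemiring (translationSemiring n) using (semiring; +-monoid)
  open import Algebra.Properties.Semiring.Exp semiring using (_^_)
  open import Algebra.Properties.Monoid.Mult +-monoid using () renaming (_×_ to _×ᵐ_)
  open FreshmansDream (translationSemiring n) using (freshmansDream)

  act-×ᵐ : ∀ k (D : List (Point n)) g x → act (k ×ᵐ D) g x ≡ + k * act D g x
  act-×ᵐ zero D g x = refl
  act-×ᵐ (suc k) D g x = trans (act-++ D (k ×ᵐ D) g x)
    (trans (cong (_+_ (act D g x)) (act-×ᵐ k D g x)) (sym (ℤ.suc-* (+ k) (act D g x))))

  act-^ : ∀ k (D : List (Point n)) g x → act (D ^ suc k) g x ≡ act D (act (D ^ k) g) x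
  act-^ k D = act-sumset D (D ^ k)

  act-[v]^ : ∀ k (v : Point n) g x → act ([ v ] ^ k) g x ≡ g (x ⊕ (+ k) · v)
  act-[v]^ zero v g x = trans (act-[𝟎] g x) (cong g (sym (trans (cong (x ⊕_) (·-zeroˡ v)) (⊕-identityʳ x))))
  act-[v]^ (suc k) v g x = begin
    act ([ v ] ^ suc k) g x         ≡⟨ act-^ k [ v ] g x ⟩
    act ([ v ] ^ k) g (x ⊕ v) + 0ℤ  ≡⟨ ℤ.+-identityʳ _ ⟩
    act ([ v ] ^ k) g (x ⊕ v)       ≡⟨ act-[v]^ k v g (x ⊕ v) ⟩
    g ((x ⊕ v) ⊕ (+ k) · v)         ≡⟨ cong (λ u → g ((x ⊕ u) ⊕ (+ k) · v)) (·-identityˡ v) ⟨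
    g ((x ⊕ 1ℤ · v) ⊕ (+ k) · v)    ≡⟨ cong g (⊕-·-+ x 1ℤ (+ k) v) ⟩
    g (x ⊕ (+ suc k) · v)           ∎
    where open ≡-Reasoning

  act-frobenius : ∀ {p} → Prime p → ∀ (D : List (Point n)) g x →
                  ∃ λ r → act (D ^ p) g x ≡ act (List.map ((+ p) ·_) D) g x + + p * r
  act-frobenius {zero} pp = contradiction pp ¬prime[0]
  act-frobenius {suc p} pp [] g x = 0ℤ , sym (trans (ℤ.+-identityˡ _) (ℤ.*-zeroʳ (+ suc p)))
  act-frobenius {p} pp (v ∷ D) g x with freshmansDream pp [ v ] D | act-frobenius pp D g x
  ... | R , [v]+D^p≈ | r , D^p≡ = act R g x + r , (begin
    act ((v ∷ D) ^ p) g x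
      ≡⟨ [v]+D^p≈ g x ⟩
    act (([ v ] ^ p ++ D ^ p) ++ p ×ᵐ R) g x
      ≡⟨ act-++ ([ v ] ^ p ++ D ^ p) (p ×ᵐ R) g x ⟩
    act ([ v ] ^ p ++ D ^ p) g x + act (p ×ᵐ R) g x
      ≡⟨ cong₂ _+_ (act-++ ([ v ] ^ p) (D ^ p) g x) (act-×ᵐ p R g x) ⟩
    (act ([ v ] ^ p) g x + act (D ^ p) g x) + + p * act R g x
      ≡⟨ cong₂ (λ a b → (a + b) + + p * act R g x) (act-[v]^ p v g x) D^p≡ ⟩
    (g (x ⊕ (+ p) · v) + (act (List.map ((+ p) ·_) D) g x + + p * r)) + + p * act R g x
      ≡⟨ regroup (g (x ⊕ (+ p) · v)) (act (List.map ((+ p) ·_) D) g x) (+ p) r (act R g x) ⟩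
    act (List.map ((+ p) ·_) (v ∷ D)) g x + + p * (act R g x + r) ∎)
    where
    open ≡-Reasoning
    regroup : ∀ a b c d e → (a + (b + c * d)) + c * e ≡ (a + b) + c * (e + d)
    regroup = solve-∀

-- Weight sums over {0,1}ⁿ

open import Algebra.Bundles using (AbelianGroup)
open import Algebra.Properties.Group (AbelianGroup.group ℤ.+-0-abelianGroup)
  using () renaming (∙-cancelʳ to +-cancelʳ)

weightSum : ∀ n → ℕ → (Point n → ℤ) → ℤ
weightSum zero zero G = G []
weightSum zero (suc j) G = 0ℤ
weightSum (suc n) zero G = weightSum n zero (λ y → G (0ℤ ∷ y))
weightSum (suc n) (suc j) G = weightSum n (suc j) (λ y → G (0ℤ ∷ y)) + weightSum n j (λ y → G (1ℤ ∷ y))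

-- markedSum n j i G sums G (d + i·eₜ) over the coordinates t and the 0/1-vectors d
-- with dₜ = 0 and exactly j ones.
markedSum : ∀ n → ℕ → ℕ → (Point n → ℤ) → ℤ
markedSum⁻ : ∀ n → ℕ → ℕ → (Point n → ℤ) → ℤ
markedSum zero j i G = 0ℤ
markedSum (suc n) j i G =
  (weightSum n j (λ y → G (+ i ∷ y)) + markedSum n j i (λ y → G (0ℤ ∷ y))) + markedSum⁻ n j i (λ y → G (1ℤ ∷ y))
markedSum⁻ n zero i G = 0ℤ
markedSum⁻ n (suc j) i G = markedSum n j i G

axialSum : ℤ → (Point n → ℤ) → Point n → ℤ
axialSum {n} c G x = ∑[ t < n ] G (x ⊕ c · 𝐞 t)

weightSum-cong : ∀ n j {G H : Point n → ℤ} → (∀ y → G y ≡ H y) → weightSum n j G ≡ weightSum n j H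
weightSum-cong zero zero G≗H = G≗H []
weightSum-cong zero (suc j) G≗H = refl
weightSum-cong (suc n) zero G≗H = weightSum-cong n zero (λ y → G≗H (0ℤ ∷ y))
weightSum-cong (suc n) (suc j) G≗H =
  cong₂ _+_ (weightSum-cong n (suc j) (λ y → G≗H (0ℤ ∷ y))) (weightSum-cong n j (λ y → G≗H (1ℤ ∷ y)))

weightSum-+ : ∀ n j (G H : Point n → ℤ) → weightSum n j (λ y → G y + H y) ≡ weightSum n j G + weightSum n j H
weightSum-+ zero zero G H = refl
weightSum-+ zero (suc j) G H = refl
weightSum-+ (suc n) zero G H = weightSum-+ n zero (λ y → G (0ℤ ∷ y)) (λ y → H (0ℤ ∷ y))
weightSum-+ (suc n) (suc j) G H =
  trans (cong₂ _+_ (weightSum-+ n (suc j) (λ y → G (0ℤ ∷ y)) (λ y → H (0ℤ ∷ y)))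
                   (weightSum-+ n j (λ y → G (1ℤ ∷ y)) (λ y → H (1ℤ ∷ y))))
        (+-interchange (weightSum n (suc j) (λ y → G (0ℤ ∷ y))) (weightSum n (suc j) (λ y → H (0ℤ ∷ y)))
                       (weightSum n j (λ y → G (1ℤ ∷ y))) (weightSum n j (λ y → H (1ℤ ∷ y))))

weightSum-* : ∀ n j a (G : Point n → ℤ) → weightSum n j (λ y → a * G y) ≡ a * weightSum n j G
weightSum-* zero zero a G = refl
weightSum-* zero (suc j) a G = sym (ℤ.*-zeroʳ a)
weightSum-* (suc n) zero a G = weightSum-* n zero a (λ y → G (0ℤ ∷ y))
weightSum-* (suc n) (suc j) a G =
  trans (cong₂ _+_ (weightSum-* n (suc j) a (λ y → G (0ℤ ∷ y))) (weightSum-* n j a (λ y → G (1ℤ ∷ y))))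
        (sym (ℤ.*-distribˡ-+ a (weightSum n (suc j) (λ y → G (0ℤ ∷ y))) (weightSum n j (λ y → G (1ℤ ∷ y)))))

weightSum-affine : ∀ n j a b (G : Point n → ℤ) →
  weightSum n j (λ y → a + b * G y) ≡ a * weightSum n j (λ _ → 1ℤ) + b * weightSum n j G
weightSum-affine n j a b G = begin
  weightSum n j (λ y → a + b * G y)                  ≡⟨ weightSum-+ n j (λ _ → a) (λ y → b * G y) ⟩
  weightSum n j (λ _ → a) + weightSum n j (λ y → b * G y)
    ≡⟨ cong₂ _+_ (trans (weightSum-cong n j (λ _ → sym (ℤ.*-identityʳ a))) (weightSum-* n j a (λ _ → 1ℤ)))
                 (weightSum-* n j b G) ⟩
  a * weightSum n j (λ _ → 1ℤ) + b * weightSum n j G ∎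
  where open ≡-Reasoning

weightSum-zero : ∀ n (G : Point n → ℤ) → weightSum n zero G ≡ G 𝟎
weightSum-zero zero G = refl
weightSum-zero (suc n) G = weightSum-zero n (λ y → G (0ℤ ∷ y))

axialSum-∷ : ∀ c (G : Point (suc n) → ℤ) x₀ x →
             axialSum c G (x₀ ∷ x) ≡ G ((x₀ + c) ∷ x) + axialSum c (λ y → G (x₀ ∷ y)) x
axialSum-∷ c G x₀ x = cong₂ _+_
  (cong G (cong₂ _∷_ (cong (_+_ x₀) (ℤ.*-identityʳ c)) (trans (cong (x ⊕_) (·-𝟎 c)) (⊕-identityʳ x))))
  (sum-cong-≗ λ t → cong (λ a → G (a ∷ (x ⊕ c · 𝐞 t))) (trans (cong (_+_ x₀) (ℤ.*-zeroʳ c)) (ℤ.+-identityʳ x₀)))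

weightSum-axialSum-∷ : ∀ n j c (G : Point (suc n) → ℤ) x₀ →
  weightSum n j (λ y → axialSum c G (x₀ ∷ y)) ≡
  weightSum n j (λ y → G ((x₀ + c) ∷ y)) + weightSum n j (axialSum c (λ y → G (x₀ ∷ y)))
weightSum-axialSum-∷ n j c G x₀ =
  trans (weightSum-cong n j (axialSum-∷ c G x₀)) (weightSum-+ n j _ (axialSum c (λ y → G (x₀ ∷ y))))

-- Shifting a vector of weight j along an axis hits either a 0-coordinate or a 1-coordinate.
weightSum-axialSum : ∀ n j i (G : Point n → ℤ) →
  weightSum n j (axialSum (+ i) G) ≡ markedSum n j i G + markedSum⁻ n j (suc i) G
weightSum-axialSum zero zero i G = refl
weightSum-axialSum zero (suc j) i G = refl
weightSum-axialSum (suc n) zero i G = begin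
  weightSum n zero (λ y → axialSum (+ i) G (0ℤ ∷ y))
    ≡⟨ weightSum-axialSum-∷ n zero (+ i) G 0ℤ ⟩
  weightSum n zero G[i] + weightSum n zero (axialSum (+ i) G[0])
    ≡⟨ cong (_+_ (weightSum n zero G[i])) (weightSum-axialSum n zero i G[0]) ⟩
  weightSum n zero G[i] + (markedSum n zero i G[0] + 0ℤ)
    ≡⟨ regroup (weightSum n zero G[i]) (markedSum n zero i G[0]) ⟩
  ((weightSum n zero G[i] + markedSum n zero i G[0]) + 0ℤ) + 0ℤ ∎
  where
  open ≡-Reasoning
  G[i] G[0] : Point n → ℤ
  G[i] y = G (+ i ∷ y)
  G[0] y = G (0ℤ ∷ y)
  regroup : ∀ a b → a + (b + 0ℤ) ≡ ((a + b) + 0ℤ) + 0ℤ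
  regroup = solve-∀
weightSum-axialSum (suc n) (suc j) i G = begin
  weightSum n (suc j) (λ y → axialSum (+ i) G (0ℤ ∷ y)) + weightSum n j (λ y → axialSum (+ i) G (1ℤ ∷ y))
    ≡⟨ cong₂ _+_ (weightSum-axialSum-∷ n (suc j) (+ i) G 0ℤ) (weightSum-axialSum-∷ n j (+ i) G 1ℤ) ⟩
  (w₁ + weightSum n (suc j) (axialSum (+ i) G[0])) + (w₂ + weightSum n j (axialSum (+ i) G[1]))
    ≡⟨ cong₂ (λ a b → (w₁ + a) + (w₂ + b)) (weightSum-axialSum n (suc j) i G[0]) (weightSum-axialSum n j i G[1]) ⟩
  (w₁ + (a₁ + a₂)) + (w₂ + (a₃ + a₄))
    ≡⟨ regroup w₁ a₁ a₂ w₂ a₃ a₄ ⟩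
  ((w₁ + a₁) + a₃) + ((w₂ + a₂) + a₄) ∎
  where
  open ≡-Reasoning
  G[0] G[1] : Point n → ℤ
  G[0] y = G (0ℤ ∷ y)
  G[1] y = G (1ℤ ∷ y)
  w₁ = weightSum n (suc j) (λ y → G (+ i ∷ y))
  w₂ = weightSum n j (λ y → G (+ suc i ∷ y))
  a₁ = markedSum n (suc j) i G[0]
  a₂ = markedSum n j (suc i) G[0]
  a₃ = markedSum n j i G[1]
  a₄ = markedSum⁻ n j (suc i) G[1]
  regroup : ∀ w₁ a₁ a₂ w₂ a₃ a₄ → (w₁ + (a₁ + a₂)) + (w₂ + (a₃ + a₄)) ≡ ((w₁ + a₁) + a₃) + ((w₂ + a₂) + a₄)
  regroup = solve-∀

-- A weight-(j+1) vector arises from j+1 choices of marked coordinate.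
markedSum-one : ∀ n j (G : Point n → ℤ) → markedSum n j 1 G ≡ + suc j * weightSum n (suc j) G
markedSum-one zero j G = sym (ℤ.*-zeroʳ (+ suc j))
markedSum-one (suc n) zero G = begin
  (weightSum n zero G[1] + markedSum n zero 1 G[0]) + 0ℤ
    ≡⟨ cong (λ a → (weightSum n zero G[1] + a) + 0ℤ) (markedSum-one n zero G[0]) ⟩
  (weightSum n zero G[1] + 1ℤ * weightSum n 1 G[0]) + 0ℤ
    ≡⟨ regroup (weightSum n zero G[1]) (weightSum n 1 G[0]) ⟩
  1ℤ * (weightSum n 1 G[0] + weightSum n zero G[1]) ∎
  where
  open ≡-Reasoning
  G[0] G[1] : Point n → ℤ
  G[0] y = G (0ℤ ∷ y)
  G[1] y = G (1ℤ ∷ y)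
  regroup : ∀ w v → (w + 1ℤ * v) + 0ℤ ≡ 1ℤ * (v + w)
  regroup = solve-∀
markedSum-one (suc n) (suc j) G = begin
  (weightSum n (suc j) G[1] + markedSum n (suc j) 1 G[0]) + markedSum n j 1 G[1]
    ≡⟨ cong₂ (λ a b → (weightSum n (suc j) G[1] + a) + b) (markedSum-one n (suc j) G[0]) (markedSum-one n j G[1]) ⟩
  (x + (1ℤ + k) * y) + k * x
    ≡⟨ regroup x y k ⟩
  (1ℤ + k) * (y + x) ∎
  where
  open ≡-Reasoning
  G[0] G[1] : Point n → ℤ
  G[0] y = G (0ℤ ∷ y)
  G[1] y = G (1ℤ ∷ y)
  x = weightSum n (suc j) G[1]
  y = weightSum n (suc (suc j)) G[0]
  k = + suc j
  regroup : ∀ x y k → (x + (1ℤ + k) * y) + k * x ≡ (1ℤ + k) * (y + x)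
  regroup = solve-∀

AffineAxial : (α β : ℕ → ℤ) → (Point n → ℤ) → Set
AffineAxial α β G = ∀ i x → axialSum (+ i) G x ≡ α i + β i * G x

-- Induction on j: markedSum-one gives the weight-(j+1) sums from the marked sums with j ones,
-- and weightSum-axialSum gives those from the weight-j sums and the marked sums with j-1 ones.
weightSum-determined : ∀ {α β} {G H : Point n → ℤ} → AffineAxial α β G → AffineAxial α β H →
                       G 𝟎 ≡ H 𝟎 → ∀ j → weightSum n j G ≡ weightSum n j H
weightSum-determined {n} {α} {β} {G} {H} G-affine H-affine G𝟎≡H𝟎 j = proj₁ (agree j)
  where
  open ≡-Reasoning

  axialSums-agree : ∀ j i → weightSum n j G ≡ weightSum n j H →
                    weightSum n j (axialSum (+ i) G) ≡ weightSum n j (axialSum (+ i) H)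
  axialSums-agree j i G≡H = begin
    weightSum n j (axialSum (+ i) G)
      ≡⟨ weightSum-cong n j (G-affine i) ⟩
    weightSum n j (λ x → α i + β i * G x)
      ≡⟨ weightSum-affine n j (α i) (β i) G ⟩
    α i * weightSum n j (λ _ → 1ℤ) + β i * weightSum n j G
      ≡⟨ cong (λ w → α i * weightSum n j (λ _ → 1ℤ) + β i * w) G≡H ⟩
    α i * weightSum n j (λ _ → 1ℤ) + β i * weightSum n j H
      ≡⟨ weightSum-affine n j (α i) (β i) H ⟨
    weightSum n j (λ x → α i + β i * H x)
      ≡⟨ weightSum-cong n j (H-affine i) ⟨
    weightSum n j (axialSum (+ i) H) ∎

  agree : ∀ j → weightSum n j G ≡ weightSum n j H × (∀ i → markedSum n j i G ≡ markedSum n j i H)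
  agree zero = weight₀ , marked₀
    where
    weight₀ = trans (weightSum-zero n G) (trans G𝟎≡H𝟎 (sym (weightSum-zero n H)))
    marked₀ : ∀ i → markedSum n zero i G ≡ markedSum n zero i H
    marked₀ i = +-cancelʳ 0ℤ _ _ (begin
      markedSum n zero i G + 0ℤ            ≡⟨ weightSum-axialSum n zero i G ⟨
      weightSum n zero (axialSum (+ i) G)  ≡⟨ axialSums-agree zero i weight₀ ⟩
      weightSum n zero (axialSum (+ i) H)  ≡⟨ weightSum-axialSum n zero i H ⟩
      markedSum n zero i H + 0ℤ            ∎)
  agree (suc j) with agree j
  ... | _ , markedⱼ = weightⱼ₊₁ , markedⱼ₊₁
    where
    weightⱼ₊₁ = ℤ.*-cancelˡ-≡ (+ suc j) _ _
      (trans (sym (markedSum-one n j G)) (trans (markedⱼ 1) (markedSum-one n j H)))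
    markedⱼ₊₁ : ∀ i → markedSum n (suc j) i G ≡ markedSum n (suc j) i H
    markedⱼ₊₁ i = +-cancelʳ (markedSum n j (suc i) G) _ _ (begin
      markedSum n (suc j) i G + markedSum n j (suc i) G
        ≡⟨ weightSum-axialSum n (suc j) i G ⟨
      weightSum n (suc j) (axialSum (+ i) G)
        ≡⟨ axialSums-agree (suc j) i weightⱼ₊₁ ⟩
      weightSum n (suc j) (axialSum (+ i) H)
        ≡⟨ weightSum-axialSum n (suc j) i H ⟩
      markedSum n (suc j) i H + markedSum n j (suc i) H
        ≡⟨ cong (_+_ (markedSum n (suc j) i H)) (markedⱼ (suc i)) ⟨
      markedSum n (suc j) i H + markedSum n j (suc i) G ∎)

AffineAxial-dilate : ∀ {α β} {G : Point n → ℤ} → AffineAxial α β G → ∀ W m →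
                     AffineAxial (λ i → α (i ℕ.* m)) (λ i → β (i ℕ.* m)) (λ x → G (W ⊕ (+ m) · x))
AffineAxial-dilate {n} {G = G} G-affine W m i x =
  trans (sum-cong-≗ (λ t → cong G (dilate-shift (𝐞 t)))) (G-affine (i ℕ.* m) (W ⊕ (+ m) · x))
  where
  dilate-shift : ∀ v → W ⊕ (+ m) · (x ⊕ (+ i) · v) ≡ (W ⊕ (+ m) · x) ⊕ (+ (i ℕ.* m)) · v
  dilate-shift v = begin
    W ⊕ (+ m) · (x ⊕ (+ i) · v)
      ≡⟨ cong (W ⊕_) (·-distribˡ-⊕ (+ m) x _) ⟩
    W ⊕ ((+ m) · x ⊕ (+ m) · (+ i) · v)
      ≡⟨ cong (λ u → W ⊕ ((+ m) · x ⊕ u)) (·-assoc (+ m) (+ i) v) ⟩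
    W ⊕ ((+ m) · x ⊕ (+ m * + i) · v)
      ≡⟨ cong (λ c → W ⊕ ((+ m) · x ⊕ c · v)) (trans (sym (ℤ.pos-* m i)) (cong +_ (ℕ.*-comm m i))) ⟩
    W ⊕ ((+ m) · x ⊕ (+ (i ℕ.* m)) · v)
      ≡⟨ ⊕-assoc W _ _ ⟨
    (W ⊕ (+ m) · x) ⊕ (+ (i ℕ.* m)) · v ∎
    where open ≡-Reasoning

-- Semi-cross tilings

open import Data.List.Relation.Unary.All using (All; []; _∷_)

corner : Fin (suc n) → Point n
corner zero = 𝟎
corner (suc t) = 𝐞 t

semiCross : ∀ n → List (Point n)
semiCross n = List.tabulate corner

𝐞≢𝟎 : ∀ (t : Fin n) → 𝐞 t ≢ 𝟎
𝐞≢𝟎 zero ()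
𝐞≢𝟎 (suc t) e≡𝟎 = 𝐞≢𝟎 t (cong Vec.tail e≡𝟎)

𝐞-injective : ∀ (i j : Fin n) → 𝐞 i ≡ 𝐞 j → i ≡ j
𝐞-injective zero zero _ = refl
𝐞-injective zero (suc j) ()
𝐞-injective (suc i) zero ()
𝐞-injective (suc i) (suc j) e≡e = cong suc (𝐞-injective i j (cong Vec.tail e≡e))

corner-injective : ∀ (i j : Fin (suc n)) → corner i ≡ corner j → i ≡ j
corner-injective zero zero _ = refl
corner-injective zero (suc j) 𝟎≡e = contradiction (sym 𝟎≡e) (𝐞≢𝟎 j)
corner-injective (suc i) zero e≡𝟎 = contradiction e≡𝟎 (𝐞≢𝟎 i)
corner-injective (suc i) (suc j) e≡e = cong suc (𝐞-injective i j e≡e)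

InSemiCross⇒corner : ∀ {v : Point n} → InSemiCross v → ∃ λ j → v ≡ corner j
InSemiCross⇒corner (inj₁ v≡𝟎) = zero , v≡𝟎
InSemiCross⇒corner (inj₂ (t , v≡e)) = suc t , v≡e

corner-InSemiCross : ∀ (j : Fin (suc n)) → InSemiCross (corner j)
corner-InSemiCross zero = inj₁ refl
corner-InSemiCross (suc t) = inj₂ (t , refl)

act-dilate-semiCross : ∀ c g (x : Point n) →
  act (dilate c (semiCross n)) g x ≡ ∑[ j < suc n ] g (x ⊕ c · corner j)
act-dilate-semiCross c g x =
  trans (cong (λ D → act D g x) (List.map-tabulate corner (c ·_))) (act-tabulate (λ j → c · corner j) g x)

module SemiCrossTiling {n} (q-prime : Prime (suc n)) {L : Pred (Point n) 0ℓ} (L? : Decidable L)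
                       (tiling : IsSemiCrossTiling n L) where

  open Frobenius n using (act-^; act-frobenius)
  open CommutativeSemiring (translationSemiring n) using (semiring)
  open import Algebra.Properties.Semiring.Exp semiring using (_^_)

  q : ℕ
  q = suc n

  f : Point n → ℤ
  f x = indicator (L? x)

  cross : ℤ → List (Point n)
  cross c = dilate c (semiCross n)

  cover : ℤ → Point n → ℤ
  cover c = act (cross c) f

  -- Tiles c says that the translates of (-c)·V by L tile ℤⁿ; the hypothesis is Tiles -1ℤ.
  Tiles : ℤ → Set
  Tiles c = ∀ x → cover c x ≡ 1ℤ

  cover-∑ : ∀ c x → cover c x ≡ ∑[ j < q ] f (x ⊕ c · corner j)
  cover-∑ c = act-dilate-semiCross c f

  act-cross-const : ∀ c a x → act (cross c) (λ _ → a) x ≡ + q * a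
  act-cross-const c a x = trans (act-const (cross c) a x)
    (cong (λ l → + l * a) (trans (List.length-map (c ·_) (semiCross n)) (List.length-tabulate (corner {n}))))

  tiles-semiCross : Tiles -1ℤ
  tiles-semiCross x = trans (cover-∑ -1ℤ x) (∑-indicator-unique (λ j → L? (x ⊕ -1ℤ · corner j)) tile unique)
    where
    tile : ∃ λ j → L (x ⊕ -1ℤ · corner j)
    tile with proj₁ (tiling x)
    ... | v , l , v∈V , l∈L , x≡v+l with InSemiCross⇒corner v∈V
    ...   | j , refl = j , subst L (⊕-translate⁻¹ x≡v+l) l∈L
    unique : ∀ {i j} → L (x ⊕ -1ℤ · corner i) → L (x ⊕ -1ℤ · corner j) → i ≡ j
    unique {i} {j} Lᵢ Lⱼ = corner-injective i j (proj₁ (proj₂ (tiling x)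
      (corner i) _ (corner j) _
      (corner-InSemiCross i) Lᵢ (⊕-translate x (corner i))
      (corner-InSemiCross j) Lⱼ (⊕-translate x (corner j))))

  cover-nonneg : ∀ c x → 0ℤ ℤ.≤ cover c x
  cover-nonneg c x =
    subst₂ ℤ._≤_ (∑-0 q) (sym (cover-∑ c x)) (∑-mono-≤ (λ j → indicator-nonneg (L? (x ⊕ c · corner j))))

  cover-≤ : ∀ c x → cover c x ℤ.≤ + q
  cover-≤ c x =
    subst₂ ℤ._≤_ (sym (cover-∑ c x)) (∑-1 q) (∑-mono-≤ (λ j → indicator≤1 (L? (x ⊕ c · corner j))))

  cover-power : ∀ {c} → Tiles c → ∀ k x → act (cross c ^ suc k) f x ≡ + (q ℕ.^ k)
  cover-power {c} tiles zero x = trans (act-^ 0 (cross c) f x) (trans (act-cong (cross c) (act-[𝟎] f) x) (tiles x))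
  cover-power {c} tiles (suc k) x = begin
    act (cross c ^ suc (suc k)) f x         ≡⟨ act-^ (suc k) (cross c) f x ⟩
    act (cross c) (act (cross c ^ suc k) f) x ≡⟨ act-cong (cross c) (cover-power {c} tiles k) x ⟩
    act (cross c) (λ _ → + (q ℕ.^ k)) x     ≡⟨ act-cross-const c (+ (q ℕ.^ k)) x ⟩
    + q * + (q ℕ.^ k)                       ≡⟨ ℤ.pos-* q (q ℕ.^ k) ⟨
    + (q ℕ.^ suc k)                         ∎
    where open ≡-Reasoning

  -- (c·V)^p acts on f as the constant q^(p-1), and (c·V)^p ≡ (pc)·V modulo p.
  cover-frobenius : ∀ {c p} → Tiles c → Prime p → ∀ x → ∃ λ r → + (q ℕ.^ (p ∸ 1)) ≡ cover (+ p * c) x + + p * r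
  cover-frobenius {c} {zero} tiles pp = contradiction pp ¬prime[0]
  cover-frobenius {c} {suc p} tiles pp x with act-frobenius pp (cross c) f x
  ... | r , frob = r , (begin
    + (q ℕ.^ p)
      ≡⟨ cover-power {c} tiles p x ⟨
    act (cross c ^ suc p) f x
      ≡⟨ frob ⟩
    act (dilate (+ suc p) (cross c)) f x + + suc p * r
      ≡⟨ cong (λ D → act D f x + + suc p * r) (dilate-dilate (+ suc p) c (semiCross n)) ⟩
    cover (+ suc p * c) x + + suc p * r ∎)
    where open ≡-Reasoning

  cover≢0 : ∀ {c p} → Tiles c → Prime p → p ∤ q → ∀ x → cover (+ p * c) x ≢ 0ℤ
  cover≢0 {c} {p} tiles pp p∤q x cover≡0 with cover-frobenius {c} tiles pp x
  ... | r , frob = p∤q (prime∣m^k⇒prime∣m (p ∸ 1) pp (ℤ.∣⇒∣ᵤ p∣q^[p-1]))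
    where
    p∣q^[p-1] : + p ℤ.∣ + (q ℕ.^ (p ∸ 1))
    p∣q^[p-1] = ℤ.divides r
      (trans frob (trans (cong (_+ + p * r) cover≡0) (trans (ℤ.+-identityˡ _) (ℤ.*-comm (+ p) r))))

  -- Each cover (p c) is ≥ 1 and, summed over -V, they total q; so each is exactly 1.
  tiles-dilate : ∀ {c p} → Tiles c → Prime p → p ∤ q → Tiles (+ p * c)
  tiles-dilate {c} {p} tiles pp p∤q x =
    trans (cong h (sym (trans (cong (x ⊕_) (·-𝟎 -1ℤ)) (⊕-identityʳ x))))
          (sym (∑-≤-≡⇒≗ 1≤h (trans (∑-1 q) (sym ∑h≡q)) zero))
    where
    open ≡-Reasoning
    h : Point n → ℤ
    h = cover (+ p * c)
    1≤h : ∀ j → 1ℤ ℤ.≤ h (x ⊕ -1ℤ · corner j)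
    1≤h j = 0≤∧≢0⇒1≤ (cover-nonneg (+ p * c) _) (cover≢0 {c} tiles pp p∤q (x ⊕ -1ℤ · corner j))
    ∑h≡q : ∑[ j < q ] h (x ⊕ -1ℤ · corner j) ≡ + q
    ∑h≡q = begin
      ∑[ j < q ] h (x ⊕ -1ℤ · corner j)           ≡⟨ act-dilate-semiCross -1ℤ h x ⟨
      act (cross -1ℤ) (act (cross (+ p * c)) f) x ≡⟨ act-comm (cross -1ℤ) (cross (+ p * c)) f x ⟩
      act (cross (+ p * c)) (cover -1ℤ) x         ≡⟨ act-cong (cross (+ p * c)) tiles-semiCross x ⟩
      act (cross (+ p * c)) (λ _ → 1ℤ) x          ≡⟨ act-cross-const (+ p * c) 1ℤ x ⟩
      + q * 1ℤ                                    ≡⟨ ℤ.*-identityʳ (+ q) ⟩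
      + q                                         ∎

  tiles-product : ∀ ps → All Prime ps → q ∤ product ps → Tiles (- + product ps)
  tiles-product [] [] _ = tiles-semiCross
  tiles-product (p ∷ ps) (pp ∷ pps) q∤pΠps =
    subst Tiles (trans (sym (ℤ.neg-distribʳ-* (+ p) (+ product ps))) (cong -_ (sym (ℤ.pos-* p (product ps)))))
      (tiles-dilate (tiles-product ps pps (λ q∣Πps → q∤pΠps (∣-trans q∣Πps (n∣m*n p)))) pp p∤q)
    where
    p∤q : p ∤ q
    p∤q p∣q with prime⇒irreducible q-prime p∣q
    ... | inj₁ refl = contradiction pp λ ()
    ... | inj₂ refl = q∤pΠps (m∣m*n (product ps))

  tiles-below : ∀ d → 1 ≤ d → d < q → Tiles (- + d)
  tiles-below d 1≤d d<q = subst (λ d → Tiles (- + d)) (sym isFactorisation)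
    (tiles-product factors factorsPrime (λ q∣d → ℕ.<⇒≱ d<q (∣⇒≤ (subst (q ∣_) (sym isFactorisation) q∣d))))
    where
    instance _ = ℕ.>-nonZero 1≤d
    open PrimeFactorisation (factorise d)

  cover≡0⇒ : ∀ c x → cover c x ≡ 0ℤ → ∀ j → f (x ⊕ c · corner j) ≡ 0ℤ
  cover≡0⇒ c x cover≡0 j =
    sym (∑-≤-≡⇒≗ (λ j → indicator-nonneg (L? (x ⊕ c · corner j)))
                 (trans (∑-0 q) (trans (sym cover≡0) (cover-∑ c x))) j)

  cover≡q⇒ : ∀ c x → cover c x ≡ + q → ∀ j → f (x ⊕ c · corner j) ≡ 1ℤ
  cover≡q⇒ c x cover≡q j =
    ∑-≤-≡⇒≗ (λ j → indicator≤1 (L? (x ⊕ c · corner j)))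
            (trans (sym (cover-∑ c x)) (trans cover≡q (sym (∑-1 q)))) j

  cover≡+∣cover∣ : ∀ c x → cover c x ≡ + ℤ.∣ cover c x ∣
  cover≡+∣cover∣ c x = sym (ℤ.0≤i⇒+∣i∣≡i (cover-nonneg c x))

  q∣cover-period : ∀ x → q ∣ ℤ.∣ cover (+ q * -1ℤ) x ∣
  q∣cover-period x with cover-frobenius { -1ℤ} tiles-semiCross q-prime x
  ... | r , frob = ℤ.∣⇒∣ᵤ (ℤ.∣m+n∣n⇒∣m {m = cover (+ q * -1ℤ) x}
    (subst (+ q ℤ.∣_) frob (ℤ.∣ᵤ⇒∣ q∣q^n)) (ℤ.∣m⇒∣m*n r (ℤ.∣-refl {+ q})))
    where
    q∣q^n : q ∣ q ℕ.^ n
    q∣q^n = m∣m^k q (ℕ.s≤s⁻¹ (ℕ.nonTrivial⇒n>1 q {{prime⇒nonTrivial q-prime}}))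

  -- cover (-q) ≡ q^(q-1) ≡ 0 (mod q) and 0 ≤ cover (-q) ≤ q, so cover (-q) is 0 or q.
  cover-period : ∀ x → cover (+ q * -1ℤ) x ≡ 0ℤ ⊎ cover (+ q * -1ℤ) x ≡ + q
  cover-period x =
    Sum.map (λ ∣cover∣≡0 → trans (cover≡+∣cover∣ c x) (cong +_ ∣cover∣≡0))
            (λ ∣cover∣≡q → trans (cover≡+∣cover∣ c x) (cong +_ ∣cover∣≡q))
            (∣∧≤⇒≡0⊎≡ (q∣cover-period x) ∣cover∣≤q)
    where
    c = + q * -1ℤ
    ∣cover∣≤q : ℤ.∣ cover c x ∣ ≤ q
    ∣cover∣≤q = ℤ.drop‿+≤+ (subst (ℤ._≤ + q) (cover≡+∣cover∣ c x) (cover-≤ c x))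

  f-periodic : ∀ x t → f (x ⊕ (+ q * -1ℤ) · 𝐞 t) ≡ f x
  f-periodic x t = trans (constant (suc t)) (cong f (trans (cong (x ⊕_) (·-𝟎 c)) (⊕-identityʳ x)))
    where
    c = + q * -1ℤ
    constant : ∀ j → f (x ⊕ c · corner j) ≡ f (x ⊕ c · 𝟎)
    constant j = Sum.[ (λ cover≡0 → trans (cover≡0⇒ c x cover≡0 j) (sym (cover≡0⇒ c x cover≡0 zero)))
                     , (λ cover≡q → trans (cover≡q⇒ c x cover≡q j) (sym (cover≡q⇒ c x cover≡q zero))) ]′
                   (cover-period x)

  f-periodic-shift : ∀ y t a s → f (y ⊕ (a + + (s ℕ.* q)) · 𝐞 t) ≡ f (y ⊕ a · 𝐞 t)
  f-periodic-shift y t a zero = cong (λ b → f (y ⊕ b · 𝐞 t)) (ℤ.+-identityʳ a)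
  f-periodic-shift y t a (suc s) = begin
    f (y ⊕ (a + + (q ℕ.+ s ℕ.* q)) · 𝐞 t)
      ≡⟨ f-periodic _ t ⟨
    f ((y ⊕ (a + + (q ℕ.+ s ℕ.* q)) · 𝐞 t) ⊕ (+ q * -1ℤ) · 𝐞 t)
      ≡⟨ cong f (⊕-·-+ y (a + + (q ℕ.+ s ℕ.* q)) (+ q * -1ℤ) (𝐞 t)) ⟩
    f (y ⊕ ((a + + (q ℕ.+ s ℕ.* q)) + + q * -1ℤ) · 𝐞 t)
      ≡⟨ cong (λ b → f (y ⊕ b · 𝐞 t)) unwind ⟩
    f (y ⊕ (a + + (s ℕ.* q)) · 𝐞 t)
      ≡⟨ f-periodic-shift y t a s ⟩
    f (y ⊕ a · 𝐞 t) ∎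
    where
    open ≡-Reasoning
    unwind : (a + + (q ℕ.+ s ℕ.* q)) + + q * -1ℤ ≡ a + + (s ℕ.* q)
    unwind = trans (cong (λ b → (a + b) + + q * -1ℤ) (ℤ.pos-+ q (s ℕ.* q))) (cancel a (+ q) (+ (s ℕ.* q)))
      where
      cancel : ∀ a b c → (a + (b + c)) + b * -1ℤ ≡ a + c
      cancel = solve-∀

  α β : ℕ → ℤ
  α c with q ∣? c
  ... | yes _ = 0ℤ
  ... | no _ = 1ℤ
  β c with q ∣? c
  ... | yes _ = + n
  ... | no _ = -1ℤ

  f-affine : AffineAxial α β f
  f-affine c x with q ∣? c
  ... | yes (divides s c≡s*q) = begin
    axialSum (+ c) f x  ≡⟨ sum-cong-≗ term ⟩
    ∑[ t < n ] f x      ≡⟨ ∑-const n (f x) ⟩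
    + n * f x           ≡⟨ ℤ.+-identityˡ _ ⟨
    0ℤ + + n * f x      ∎
    where
    open ≡-Reasoning
    term : ∀ t → f (x ⊕ (+ c) · 𝐞 t) ≡ f x
    term t = begin
      f (x ⊕ (+ c) · 𝐞 t)
        ≡⟨ cong (λ b → f (x ⊕ b · 𝐞 t)) (trans (cong +_ c≡s*q) (sym (ℤ.+-identityˡ _))) ⟩
      f (x ⊕ (0ℤ + + (s ℕ.* q)) · 𝐞 t)
        ≡⟨ f-periodic-shift x t 0ℤ s ⟩
      f (x ⊕ 0ℤ · 𝐞 t)
        ≡⟨ cong f (trans (cong (x ⊕_) (·-zeroˡ (𝐞 t))) (⊕-identityʳ x)) ⟩
      f x ∎
  ... | no q∤c with ∤⇒+≡suc* q∤c
  ... | d , s , 1≤d , d<q , c+d≡[1+s]q = begin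
    axialSum (+ c) f x
      ≡⟨ sum-cong-≗ term ⟩
    axialSum (- + d) f x
      ≡⟨ add-subtract (f (x ⊕ (- + d) · 𝟎)) _ ⟩
    (f (x ⊕ (- + d) · 𝟎) + axialSum (- + d) f x) + -1ℤ * f (x ⊕ (- + d) · 𝟎)
      ≡⟨ cong (λ a → a + -1ℤ * f (x ⊕ (- + d) · 𝟎)) (cover-∑ (- + d) x) ⟨
    cover (- + d) x + -1ℤ * f (x ⊕ (- + d) · 𝟎)
      ≡⟨ cong₂ (λ a b → a + -1ℤ * f b) (tiles-below d 1≤d d<q x)
               (trans (cong (x ⊕_) (·-𝟎 (- + d))) (⊕-identityʳ x)) ⟩
    1ℤ + -1ℤ * f x ∎
    where
    open ≡-Reasoning
    add-subtract : ∀ a b → b ≡ (a + b) + -1ℤ * a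
    add-subtract = solve-∀
    +c≡-d+[1+s]q : + c ≡ - + d + + (suc s ℕ.* q)
    +c≡-d+[1+s]q = trans (cancel (+ c) (+ d)) (cong (λ m → - + d + m) (trans (sym (ℤ.pos-+ c d)) (cong +_ c+d≡[1+s]q)))
      where
      cancel : ∀ a b → a ≡ - b + (a + b)
      cancel = solve-∀
    term : ∀ t → f (x ⊕ (+ c) · 𝐞 t) ≡ f (x ⊕ (- + d) · 𝐞 t)
    term t = trans (cong (λ b → f (x ⊕ b · 𝐞 t)) +c≡-d+[1+s]q) (f-periodic-shift x t (- + d) (suc s))

  α-β-dilate : ∀ {m} → 1 ≤ m → m < q → ∀ i → α (i ℕ.* m) ≡ α i × β (i ℕ.* m) ≡ β i
  α-β-dilate {m} 1≤m m<q i with q ∣? i ℕ.* m | q ∣? i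
  ... | yes _ | yes _ = refl , refl
  ... | no _ | no _ = refl , refl
  ... | no q∤im | yes q∣i = contradiction (∣-trans q∣i (m∣m*n m)) q∤im
  ... | yes q∣im | no q∤i with euclidsLemma i m q-prime q∣im
  ...   | inj₁ q∣i = contradiction q∣i q∤i
  ...   | inj₂ q∣m = contradiction (∣⇒≤ {{ℕ.>-nonZero 1≤m}} q∣m) (ℕ.<⇒≱ m<q)

  f-dilate-affine : ∀ W {m} → 1 ≤ m → m < q → AffineAxial α β (λ x → f (W ⊕ (+ m) · x))
  f-dilate-affine W {m} 1≤m m<q i x with α-β-dilate 1≤m m<q i
  ... | α≡ , β≡ = trans (AffineAxial-dilate {α = α} {β} {f} f-affine W m i x)
                        (cong₂ (λ a b → a + b * f (W ⊕ (+ m) · x)) α≡ β≡)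

open import Data.Vec.Relation.Unary.All using (All; []; _∷_)
open import Data.Bool using (if_then_else_)
open import Function using (id; _$_)

module _ {M : ℤ} (M≢0 : M ≢ 0ℤ) where

  count-0∷ : ∀ (d : Point n) → count (_≟ℤ M) (0ℤ ∷ d) ≡ count (_≟ℤ M) d
  count-0∷ d = cong (λ b → if b then suc else id $ count (_≟ℤ M) d)
                    (Dec.dec-false (0ℤ ≟ℤ M) (λ 0≡M → M≢0 (sym 0≡M)))

  count-M∷ : ∀ (d : Point n) → count (_≟ℤ M) (M ∷ d) ≡ suc (count (_≟ℤ M) d)
  count-M∷ d = cong (λ b → if b then suc else id $ count (_≟ℤ M) d) (Dec.dec-true (M ≟ℤ M) refl)

  HasShape-0∷ : ∀ k (d : Point n) → HasShape M k (0ℤ ∷ d) ⇔ HasShape M k d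
  HasShape-0∷ k d =
    mk⇔ (λ { (_ ∷ entries , counted) → entries , trans (sym (count-0∷ d)) counted })
        (λ { (entries , counted) → inj₂ refl ∷ entries , trans (count-0∷ d) counted })

  HasShape-M∷ : ∀ k (d : Point n) → HasShape M (suc k) (M ∷ d) ⇔ HasShape M k d
  HasShape-M∷ k d =
    mk⇔ (λ { (_ ∷ entries , counted) → entries , ℕ.suc-injective (trans (sym (count-M∷ d)) counted) })
        (λ { (entries , counted) → inj₁ refl ∷ entries , trans (count-M∷ d) (cong suc counted) })

  ¬HasShape-M∷ : ∀ (d : Point n) → ¬ HasShape M 0 (M ∷ d)
  ¬HasShape-M∷ d (_ , counted) with trans (sym (count-M∷ d)) counted
  ... | ()

  open ≡-Reasoning

  listSum-vecsOver : ∀ n k (H : Point n → ℤ) →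
    listSum (λ d → H d * indicator (hasShape? M k d)) (vecsOver M n) ≡ weightSum n k (λ y → H (M · y))
  listSum-vecsOver zero zero H =
    trans (ℤ.+-identityʳ _)
      (trans (cong (H [] *_) (indicator-yes ([] , refl) (hasShape? M 0 []))) (ℤ.*-identityʳ (H [])))
  listSum-vecsOver zero (suc k) H =
    trans (ℤ.+-identityʳ _)
      (trans (cong (H [] *_) (indicator-no (λ ()) (hasShape? M (suc k) []))) (ℤ.*-zeroʳ (H [])))
  listSum-vecsOver (suc n) k H = trans (listSum-concatMap-pair _ (0ℤ ∷_) (M ∷_) (vecsOver M n)) (split k)
    where
    shapeSum : ∀ k → ℤ → ℤ
    shapeSum k a = listSum (λ d → H (a ∷ d) * indicator (hasShape? M k (a ∷ d))) (vecsOver M n)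
    head0 : ∀ k → shapeSum k 0ℤ ≡ weightSum n k (λ y → H (M * 0ℤ ∷ M · y))
    head0 k = begin
      shapeSum k 0ℤ
        ≡⟨ listSum-cong (λ d → cong (H (0ℤ ∷ d) *_) (indicator-⇔ (HasShape-0∷ k d) _ (hasShape? M k d)))
                        (vecsOver M n) ⟩
      listSum (λ d → H (0ℤ ∷ d) * indicator (hasShape? M k d)) (vecsOver M n)
        ≡⟨ listSum-vecsOver n k (λ d → H (0ℤ ∷ d)) ⟩
      weightSum n k (λ y → H (0ℤ ∷ M · y))
        ≡⟨ weightSum-cong n k (λ y → cong (λ a → H (a ∷ M · y)) (sym (ℤ.*-zeroʳ M))) ⟩
      weightSum n k (λ y → H (M * 0ℤ ∷ M · y)) ∎
    headM : ∀ k → shapeSum (suc k) M ≡ weightSum n k (λ y → H (M * 1ℤ ∷ M · y))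
    headM k = begin
      shapeSum (suc k) M
        ≡⟨ listSum-cong (λ d → cong (H (M ∷ d) *_) (indicator-⇔ (HasShape-M∷ k d) _ (hasShape? M k d)))
                        (vecsOver M n) ⟩
      listSum (λ d → H (M ∷ d) * indicator (hasShape? M k d)) (vecsOver M n)
        ≡⟨ listSum-vecsOver n k (λ d → H (M ∷ d)) ⟩
      weightSum n k (λ y → H (M ∷ M · y))
        ≡⟨ weightSum-cong n k (λ y → cong (λ a → H (a ∷ M · y)) (sym (ℤ.*-identityʳ M))) ⟩
      weightSum n k (λ y → H (M * 1ℤ ∷ M · y)) ∎
    split : ∀ k → shapeSum k 0ℤ + shapeSum k M ≡ weightSum (suc n) k (λ y → H (M · y))
    headM-zero : shapeSum zero M ≡ 0ℤ
    headM-zero = begin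
      shapeSum zero M
        ≡⟨ listSum-cong (λ d → trans (cong (H (M ∷ d) *_) (indicator-no (¬HasShape-M∷ d) _)) (ℤ.*-zeroʳ (H (M ∷ d))))
                        (vecsOver M n) ⟩
      listSum (λ _ → 0ℤ) (vecsOver M n)
        ≡⟨ listSum-const 0ℤ (vecsOver M n) ⟩
      + length (vecsOver M n) * 0ℤ
        ≡⟨ ℤ.*-zeroʳ (+ length (vecsOver M n)) ⟩
      0ℤ ∎
    split zero = trans (cong₂ _+_ (head0 zero) headM-zero) (ℤ.+-identityʳ _)
    split (suc k) = cong₂ _+_ (head0 (suc k)) (headM k)

countShape≡weightSum : ∀ {L : Pred (Point n) 0ℓ} (L? : Decidable L) W {m} → m ≢ 0 → ∀ k →
  + countShape L L? W (+ m) k ≡ weightSum n k (λ y → indicator (L? (W ⊕ (+ m) · y)))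
countShape≡weightSum {n} {L} L? W {m} m≢0 k = begin
  + length (filter P? (List.map (W ⊕_) (vecsOver (+ m) n)))
    ≡⟨ length-filter P? (List.map (W ⊕_) (vecsOver (+ m) n)) ⟩
  listSum (λ Z → indicator (P? Z)) (List.map (W ⊕_) (vecsOver (+ m) n))
    ≡⟨ listSum-map (λ Z → indicator (P? Z)) (W ⊕_) (vecsOver (+ m) n) ⟩
  listSum (λ d → indicator (P? (W ⊕ d))) (vecsOver (+ m) n)
    ≡⟨ listSum-cong indicator-split (vecsOver (+ m) n) ⟩
  listSum (λ d → indicator (L? (W ⊕ d)) * indicator (hasShape? (+ m) k d)) (vecsOver (+ m) n)
    ≡⟨ listSum-vecsOver (λ +m≡0 → m≢0 (ℤ.+-injective +m≡0)) n k (λ d → indicator (L? (W ⊕ d))) ⟩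
  weightSum n k (λ y → indicator (L? (W ⊕ (+ m) · y))) ∎
  where
  open ≡-Reasoning
  P : Pred (Point n) 0ℓ
  P Z = L Z × HasShape (+ m) k (Z ⊖ W)
  P? : Decidable P
  P? Z = L? Z Dec.×-dec hasShape? (+ m) k (Z ⊖ W)
  indicator-split : ∀ d → indicator (P? (W ⊕ d)) ≡ indicator (L? (W ⊕ d)) * indicator (hasShape? (+ m) k d)
  indicator-split d = trans (indicator-× (L? (W ⊕ d)) (hasShape? (+ m) k ((W ⊕ d) ⊖ W)))
    (cong (λ v → indicator (L? (W ⊕ d)) * indicator (hasShape? (+ m) k v)) (⊕-⊖-cancelˡ W d))

corollary27 : (q : ℕ) → Prime q →
    (L : Pred (Point (q ∸ 1)) 0ℓ) → (L? : Decidable L) →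
    IsSemiCrossTiling (q ∸ 1) L →
    (W : Point (q ∸ 1)) → (m k : ℕ) →
    1 ≤ m → m ≤ q ∸ 1 → 1 ≤ k → k ≤ q ∸ 1 →
    countShape L L? W (+ m) k ≡ countShape L L? W (+ 1) k
corollary27 zero q-prime = contradiction q-prime ¬prime[0]
corollary27 (suc n) q-prime L L? tiling W m k 1≤m m≤n _ _ = ℤ.+-injective (begin
  + countShape L L? W (+ m) k
    ≡⟨ countShape≡weightSum L? W (ℕ.>⇒≢ 1≤m) k ⟩
  weightSum n k (λ y → f (W ⊕ (+ m) · y))
    ≡⟨ weightSum-determined {α = α} {β} (f-dilate-affine W 1≤m (s≤s m≤n))
         (f-dilate-affine W (s≤s z≤n) (s≤s (ℕ.≤-trans 1≤m m≤n)))
         (cong (λ v → f (W ⊕ v)) (trans (·-𝟎 (+ m)) (sym (·-𝟎 1ℤ)))) k ⟩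
  weightSum n k (λ y → f (W ⊕ (+ 1) · y))
    ≡⟨ countShape≡weightSum L? W (λ ()) k ⟨
  + countShape L L? W (+ 1) k ∎)
  where
  open ≡-Reasoning
  open SemiCrossTiling q-prime L? tiling using (f; α; β; f-dilate-affine)
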